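{- Let $s$ and $t$ be positive integers with $s$ odd, and either $t$ odd or $t=2^m$ for some positive integer $m$. Then \[\operatorname{aw}(\mathbb{Z}_{st},3) \le \operatorname{aw}(\mathbb{Z}_{t},3)+ \operatorname{aw}(\mathbb{Z}_s,3) - 2.\]
   Context: $\mathbb{Z}_n$ is the cyclic group of integers mod $n$. A $3$-AP in $\mathbb{Z}_n$ is a set of three distinct elements $a,a+d,a+2d$ (mod $n$), $d\not\equiv0$. An $r$-coloring is a map $\mathbb{Z}_n\to\{1,\dots,r\}$, exact if surjective; a $3$-AP is rainbow if its elements receive distinct colors. $\operatorname{aw}(\mathbb{Z}_n,3)$ is the smallest $r$ such that every exact $r$-coloring of $\mathbb{Z}_n$ contains a rainbow $3$-AP (with value $n+1$ if $n<3$). -}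

module Defs where

open import Data.Nat using (ℕ; zero; suc; _+_; _*_; _^_; _≤_; _<_)
open import Data.Nat.DivMod using (_mod_)
open import Data.Fin using (Fin; toℕ)
open import Data.Product using (Σ; _×_; ∃; ∃-syntax)
open import Function.Definitions using (Surjective)
open import Relation.Binary.PropositionalEquality using (_≡_; _≢_)
open import Relation.Nullary using (¬_)

Odd : ℕ → Set
Odd s = ∃[ k ] s ≡ suc (2 * k)

_⊕_ : ∀ {n} → Fin n → Fin n → Fin n
_⊕_ {suc k} a b = (toℕ a + toℕ b) mod suc k

Coloring : ℕ → ℕ → Set
Coloring n r = Fin n → Fin r

Exact : ∀ {n r} → Coloring n r → Set
Exact {n} {r} c = Surjective _≡_ _≡_ c

Is3AP : ∀ {n} → Fin n → Fin n → Set
Is3AP a d = (toℕ d ≢ 0) × (a ≢ a ⊕ d) × (a ≢ (a ⊕ d) ⊕ d) × (a ⊕ d ≢ (a ⊕ d) ⊕ d)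

HasRainbow3AP : ∀ {n r} → Coloring n r → Set
HasRainbow3AP {n} c = Σ (Fin n) λ a → Σ (Fin n) λ d →
  Is3AP a d × (c a ≢ c (a ⊕ d)) × (c a ≢ c ((a ⊕ d) ⊕ d))
    × (c (a ⊕ d) ≢ c ((a ⊕ d) ⊕ d))

AllExactRainbow : ℕ → ℕ → Set
AllExactRainbow n r = (c : Coloring n r) → Exact c → HasRainbow3AP c

IsAw : ℕ → ℕ → Set
IsAw n r =
  (n < 3 → r ≡ n + 1) ×
  (3 ≤ n → (1 ≤ r) × AllExactRainbow n r
             × (∀ r′ → 1 ≤ r′ → r′ < r → ¬ AllExactRainbow n r′))

module Submission where

-- Write n = st, b = aw(ℤ_t,3), c = aw(ℤ_s,3), and let χ be an exact colouring of ℤ_n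
-- with N colours and no rainbow 3-AP.  The cosets i + tℤ_n (i ∈ ℤ_t) are copies of
-- ℤ_s, so χ restricted to one of them is rainbow-free and sees at most c − 1 colours.
-- Let A be the colour set of a coset seeing the most colours.  Since s is odd, points
-- can be halved inside cosets, so the absence of rainbow triples p + r ≡ 2q (mod n)
-- propagates colours along progressions of cosets (extend, interpolate).  Hence every
-- coset sees at most one colour outside A (exchange plus maximality of A), and marking
-- each coset by that colour, or by 0 if there is none, is a rainbow-free colouring φ
-- of ℤ_t; it uses at most b − 1 values, one of them 0.  So N ≤ (c − 1) + (b − 2):
-- every exact (b + c − 2)-colouring of ℤ_n has a rainbow 3-AP, and minimality of
-- aw(ℤ_n,3) gives the theorem.

open import Defs
open import Data.Nat using (ℕ; _+_; _*_; _^_; _≤_)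
open import Data.Product using (∃-syntax; _×_)
open import Data.Sum using (_⊎_)
open import Relation.Binary.PropositionalEquality using (_≡_)

open import Level using (0ℓ)
open import Data.Nat using (zero; suc; _<_; _%_; _/_; _∸_; _⊓_; z≤n; s≤s; s≤s⁻¹; _<?_; _≤?_)
open import Data.Nat.Properties
open import Data.Nat.DivMod using (_mod_; m%n<n; m%n%n≡m%n; [m+kn]%n≡m%n; m<n⇒m%n≡m; %-distribˡ-+; m∣n⇒o%n%m≡o%m; m≡m%n+[m/n]*n)
open import Data.Nat.Divisibility using (_∣_; divides)
open import Data.Nat.Tactic.RingSolver using (solve-∀)
open import Data.Fin as F using (Fin; toℕ; fromℕ<)
open import Data.Fin.Properties as FP using (toℕ-injective; toℕ-fromℕ<; toℕ<n)
open import Data.Bool using (Bool; true; false; T; _∧_; _∨_; not)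
open import Data.Bool.Properties using (T-∨)
open import Data.Product using (_,_; proj₁; proj₂; ∃₂; map₁)
open import Data.Sum using (inj₁; inj₂; [_,_]; map₂)
open import Data.Empty using (⊥; ⊥-elim)
open import Data.Unit using (tt)
open import Function using (_∘_; Equivalence)
open import Relation.Nullary using (¬_; yes; no; Dec; isYes; toWitness; fromWitness; T?; toSum)
open import Relation.Nullary.Decidable using (_×-dec_; ¬?; decidable-stable)
open import Relation.Binary using (IsEquivalence; Setoid)
open import Relation.Binary.PropositionalEquality using (_≢_; refl; sym; trans; cong; cong₂; subst; module ≡-Reasoning)
import Relation.Binary.Reasoning.Setoid as SetoidReasoning

-- Congruence modulo m = suc m′ on ℕ.  It is a record (rather than the bare
-- equation a % m ≡ b % m) so that both sides stay inferable.
module Congruence (m′ : ℕ) where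
  m : ℕ
  m = suc m′

  infix 4 _≈_
  record _≈_ (a b : ℕ) : Set where
    constructor mod≡
    field mod-eq : a % m ≡ b % m

  ≈-isEquivalence : IsEquivalence _≈_
  ≈-isEquivalence = record
    { refl  = mod≡ refl
    ; sym   = λ { (mod≡ p) → mod≡ (sym p) }
    ; trans = λ { (mod≡ p) (mod≡ q) → mod≡ (trans p q) }
    }

  ≈-setoid : Setoid 0ℓ 0ℓ
  ≈-setoid = record { isEquivalence = ≈-isEquivalence }

  open IsEquivalence ≈-isEquivalence public
    using () renaming (refl to ≈-refl; sym to ≈-sym; trans to ≈-trans)
  module ≈-Reasoning = SetoidReasoning ≈-setoid

  ≡⇒≈ : ∀ {a b} → a ≡ b → a ≈ b
  ≡⇒≈ refl = ≈-refl

  ≈-+ : ∀ {a b c d} → a ≈ b → c ≈ d → a + c ≈ b + d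
  ≈-+ {a} {b} {c} {d} (mod≡ p) (mod≡ q) = mod≡ (begin
    (a + c) % m         ≡⟨ %-distribˡ-+ a c m ⟩
    (a % m + c % m) % m ≡⟨ cong₂ (λ u v → (u + v) % m) p q ⟩
    (b % m + d % m) % m ≡⟨ sym (%-distribˡ-+ b d m) ⟩
    (b + d) % m         ∎)
    where open ≡-Reasoning

  +-multiple : ∀ a k → a + m * k ≈ a
  +-multiple a k = mod≡ (trans (cong (λ u → (a + u) % m) (*-comm m k)) ([m+kn]%n≡m%n a k m))

  %-≈ : ∀ a → a % m ≈ a
  %-≈ a = mod≡ (m%n%n≡m%n a m)

  -- A representative of b − a: a + (b ⊖ a) ≈ b.
  _⊖_ : ℕ → ℕ → ℕ
  b ⊖ a = b + m′ * a

  ⊖-inverse : ∀ a b → a + (b ⊖ a) ≈ b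
  ⊖-inverse a b = ≈-trans (≡⇒≈ (rearrange a b m′)) (+-multiple b a)
    where
    rearrange : ∀ a b m′ → a + (b + m′ * a) ≡ b + suc m′ * a
    rearrange = solve-∀

  ⊖-cancel : ∀ c a → (c + a) ⊖ c ≈ a
  ⊖-cancel c a = ≈-trans (≡⇒≈ (rearrange c a m′)) (+-multiple a c)
    where
    rearrange : ∀ c a m′ → c + a + m′ * c ≡ a + suc m′ * c
    rearrange = solve-∀

  ≈-cancelˡ : ∀ c {a b} → c + a ≈ c + b → a ≈ b
  ≈-cancelˡ c {a} {b} p = begin
    a               ≈⟨ ⊖-cancel c a ⟨
    (c + a) ⊖ c     ≈⟨ ≈-+ p ≈-refl ⟩
    (c + b) ⊖ c     ≈⟨ ⊖-cancel c b ⟩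
    b               ∎
    where open ≈-Reasoning

  mod-cong : ∀ {a b} → a ≈ b → a mod m ≡ b mod m
  mod-cong {a} {b} (mod≡ p) =
    toℕ-injective (trans (toℕ-fromℕ< (m%n<n a m)) (trans p (sym (toℕ-fromℕ< (m%n<n b m)))))

  toℕ-mod : ∀ a → toℕ (a mod m) ≡ a % m
  toℕ-mod a = toℕ-fromℕ< (m%n<n a m)

  toℕ-mod-≈ : ∀ a → toℕ (a mod m) ≈ a
  toℕ-mod-≈ a = ≈-trans (≡⇒≈ (toℕ-mod a)) (%-≈ a)

  mod-toℕ : ∀ (i : Fin m) → toℕ i mod m ≡ i
  mod-toℕ i = toℕ-injective (trans (toℕ-mod (toℕ i)) (m<n⇒m%n≡m (toℕ<n i)))

≈-divisor : ∀ d′ m′ {a b} → suc d′ ∣ suc m′ → Congruence._≈_ m′ a b → Congruence._≈_ d′ a b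
≈-divisor d′ m′ {a} {b} d∣m (Congruence.mod≡ p) = Congruence.mod≡ (begin
  a % d           ≡⟨ m∣n⇒o%n%m≡o%m d (suc m′) a d∣m ⟨
  a % suc m′ % d  ≡⟨ cong (_% d) p ⟩
  b % suc m′ % d  ≡⟨ m∣n⇒o%n%m≡o%m d (suc m′) b d∣m ⟩
  b % d           ∎)
  where
  d : ℕ
  d = suc d′
  open ≡-Reasoning

FinSet : ℕ → Set
FinSet K = Fin K → Bool

infix 4 _∈_
_∈_ : ∀ {K} → Fin K → FinSet K → Set
x ∈ S = T (S x)

infixl 6 _∪_ _∖_
infixl 7 _∩_
_∪_ _∩_ _∖_ : ∀ {K} → FinSet K → FinSet K → FinSet K
(S ∪ S′) x = S x ∨ S′ x
(S ∩ S′) x = S x ∧ S′ x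
(S ∖ S′) x = S x ∧ not (S′ x)

∪⁺ : ∀ {K} (S S′ : FinSet K) {x} → x ∈ S ⊎ x ∈ S′ → x ∈ S ∪ S′
∪⁺ S S′ = Equivalence.from T-∨

∖⁺ : ∀ {K} (S S′ : FinSet K) {x} → x ∈ S → ¬ x ∈ S′ → x ∈ S ∖ S′
∖⁺ S S′ {x} x∈S x∉S′ with S x | S′ x
... | true | true  = x∉S′ tt
... | true | false = tt

∖⁻ : ∀ {K} (S S′ : FinSet K) {x} → x ∈ S ∖ S′ → x ∈ S × ¬ x ∈ S′
∖⁻ S S′ {x} x∈ with S x | S′ x
... | true | false = tt , λ ()

bit : Bool → ℕ
bit true  = 1
bit false = 0

∣_∣ : ∀ {K} → FinSet K → ℕ
∣_∣ {zero}  S = 0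
∣_∣ {suc K} S = bit (S F.zero) + ∣ S ∘ F.suc ∣

bit-mono : ∀ {a b} → (T a → T b) → bit a ≤ bit b
bit-mono {false}         _ = z≤n
bit-mono {true}  {true}  _ = ≤-refl
bit-mono {true}  {false} h = ⊥-elim (h tt)

bit-member : ∀ {a} → T a → bit a ≡ 1
bit-member {true} _ = refl

∣∣-mono : ∀ {K} (S S′ : FinSet K) → (∀ x → x ∈ S → x ∈ S′) → ∣ S ∣ ≤ ∣ S′ ∣
∣∣-mono {zero}  S S′ _ = z≤n
∣∣-mono {suc K} S S′ h = +-mono-≤ (bit-mono (h F.zero)) (∣∣-mono (S ∘ F.suc) (S′ ∘ F.suc) (h ∘ F.suc))

full : ∀ {K} → FinSet K
full _ = true

∣full∣ : ∀ K → ∣ full {K} ∣ ≡ K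
∣full∣ zero    = refl
∣full∣ (suc K) = cong suc (∣full∣ K)

interchange : ∀ a b c d → (a + b) + (c + d) ≡ (a + c) + (b + d)
interchange = solve-∀

∣∪∣≤ : ∀ {K} (S S′ : FinSet K) → ∣ S ∪ S′ ∣ ≤ ∣ S ∣ + ∣ S′ ∣
∣∪∣≤ {zero}  S S′ = z≤n
∣∪∣≤ {suc K} S S′ = begin
  bit (S F.zero ∨ S′ F.zero) + ∣ (S ∘ F.suc) ∪ (S′ ∘ F.suc) ∣
    ≤⟨ +-mono-≤ (bit-∨ (S F.zero) (S′ F.zero)) (∣∪∣≤ (S ∘ F.suc) (S′ ∘ F.suc)) ⟩
  (bit (S F.zero) + bit (S′ F.zero)) + (∣ S ∘ F.suc ∣ + ∣ S′ ∘ F.suc ∣)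
    ≡⟨ interchange (bit (S F.zero)) _ _ _ ⟩
  ∣ S ∣ + ∣ S′ ∣ ∎
  where
  open ≤-Reasoning
  bit-∨ : ∀ a b → bit (a ∨ b) ≤ bit a + bit b
  bit-∨ true  b = s≤s z≤n
  bit-∨ false b = ≤-refl

∣∣-split : ∀ {K} (S S′ : FinSet K) → ∣ S ∣ ≡ ∣ S ∩ S′ ∣ + ∣ S ∖ S′ ∣
∣∣-split {zero}  S S′ = refl
∣∣-split {suc K} S S′ = trans
  (cong₂ _+_ (bit-split (S F.zero) (S′ F.zero)) (∣∣-split (S ∘ F.suc) (S′ ∘ F.suc)))
  (interchange (bit (S F.zero ∧ S′ F.zero)) _ _ _)
  where
  bit-split : ∀ a b → bit a ≡ bit (a ∧ b) + bit (a ∧ not b)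
  bit-split true  true  = refl
  bit-split true  false = refl
  bit-split false b     = refl

∣∖∣-mono : ∀ {K} (S S′ : FinSet K) → ∣ S ∣ ≤ ∣ S′ ∣ → ∣ S ∖ S′ ∣ ≤ ∣ S′ ∖ S ∣
∣∖∣-mono S S′ S≤S′ = +-cancelˡ-≤ ∣ S ∩ S′ ∣ _ _ (begin
  ∣ S ∩ S′ ∣ + ∣ S ∖ S′ ∣   ≡⟨ ∣∣-split S S′ ⟨
  ∣ S ∣                     ≤⟨ S≤S′ ⟩
  ∣ S′ ∣                    ≡⟨ ∣∣-split S′ S ⟩
  ∣ S′ ∩ S ∣ + ∣ S′ ∖ S ∣   ≤⟨ +-monoˡ-≤ _ (∣∣-mono (S′ ∩ S) (S ∩ S′) λ x → swap (S′ x) (S x)) ⟩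
  ∣ S ∩ S′ ∣ + ∣ S′ ∖ S ∣   ∎)
  where
  open ≤-Reasoning
  swap : ∀ a b → T (a ∧ b) → T (b ∧ a)
  swap true  true  _ = tt

∣∣-positive : ∀ {K} {S : FinSet K} x → x ∈ S → 1 ≤ ∣ S ∣
∣∣-positive {S = S} F.zero    x∈S = ≤-trans (≤-reflexive (sym (bit-member x∈S))) (m≤m+n _ _)
∣∣-positive {S = S} (F.suc x) x∈S = ≤-trans (∣∣-positive x x∈S) (m≤n+m _ _)

∣∣-two : ∀ {K} {S : FinSet K} {x y} → x ≢ y → x ∈ S → y ∈ S → 2 ≤ ∣ S ∣
∣∣-two {x = F.zero}  {F.zero}  x≢y _ _ = ⊥-elim (x≢y refl)
∣∣-two {x = F.zero}  {F.suc y} _ x∈S y∈S =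
  ≤-trans (≤-reflexive (cong (_+ 1) (sym (bit-member x∈S)))) (+-monoʳ-≤ _ (∣∣-positive y y∈S))
∣∣-two {x = F.suc x} {F.zero}  _ x∈S y∈S =
  ≤-trans (≤-reflexive (cong (_+ 1) (sym (bit-member y∈S)))) (+-monoʳ-≤ _ (∣∣-positive x x∈S))
∣∣-two {x = F.suc x} {F.suc y} x≢y x∈S y∈S =
  ≤-trans (∣∣-two (x≢y ∘ cong F.suc) x∈S y∈S) (m≤n+m _ _)

member : ∀ {K} (S : FinSet K) → 1 ≤ ∣ S ∣ → ∃[ x ] x ∈ S
member {suc K} S pos with S F.zero in eq
... | true  = F.zero , subst T (sym eq) tt
... | false = let x , x∈S = member (S ∘ F.suc) pos in F.suc x , x∈S

two-members : ∀ {K} (S : FinSet K) → 2 ≤ ∣ S ∣ → ∃₂ λ x y → x ≢ y × x ∈ S × y ∈ S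
two-members {suc K} S two with S F.zero in eq
... | true  = let y , y∈S = member (S ∘ F.suc) (s≤s⁻¹ two)
              in F.zero , F.suc y , (λ ()) , subst T (sym eq) tt , y∈S
... | false = let x , y , x≢y , x∈S , y∈S = two-members (S ∘ F.suc) two
              in F.suc x , F.suc y , x≢y ∘ FP.suc-injective , x∈S , y∈S

∣∣≤1 : ∀ {K} (S : FinSet K) → (∀ {x y} → x ∈ S → y ∈ S → x ≡ y) → ∣ S ∣ ≤ 1
∣∣≤1 S unique = ≮⇒≥ λ two → let _ , _ , x≢y , x∈S , y∈S = two-members S two in x≢y (unique x∈S y∈S)

image : ∀ {m K} → (Fin m → Fin K) → FinSet K
image f γ = isYes (FP.any? λ k → f k F.≟ γ)

image⁺ : ∀ {m K} (f : Fin m → Fin K) k {γ} → f k ≡ γ → γ ∈ image f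
image⁺ f k fk≡γ = fromWitness (k , fk≡γ)

image⁻ : ∀ {m K} (f : Fin m → Fin K) {γ} → γ ∈ image f → ∃[ k ] f k ≡ γ
image⁻ f = toWitness

∣image∣≤ : ∀ {m K} (f : Fin m → Fin K) → ∣ image f ∣ ≤ m
∣image∣≤ {zero}  f = ≮⇒≥ (empty ∘ member (image f))
  where
  empty : ¬ (∃[ γ ] γ ∈ image f)
  empty (γ , γ∈) with image⁻ f {γ} γ∈
  ... | () , _
∣image∣≤ {suc m} f = begin
  ∣ image f ∣                              ≤⟨ ∣∣-mono (image f) (image first ∪ image (f ∘ F.suc)) split ⟩
  ∣ image first ∪ image (f ∘ F.suc) ∣      ≤⟨ ∣∪∣≤ (image first) _ ⟩
  ∣ image first ∣ + ∣ image (f ∘ F.suc) ∣  ≤⟨ +-mono-≤ (∣∣≤1 (image first) same) (∣image∣≤ (f ∘ F.suc)) ⟩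
  1 + m                                    ∎
  where
  open ≤-Reasoning
  first : Fin 1 → _
  first _ = f F.zero
  same : ∀ {x y} → x ∈ image first → y ∈ image first → x ≡ y
  same {x} {y} x∈ y∈ with image⁻ first {x} x∈ | image⁻ first {y} y∈
  ... | F.zero , refl | F.zero , refl = refl
  split : ∀ γ → γ ∈ image f → γ ∈ image first ∪ image (f ∘ F.suc)
  split γ γ∈ with image⁻ f {γ} γ∈
  ... | F.zero  , fk≡γ = ∪⁺ (image first) (image (f ∘ F.suc)) (inj₁ (image⁺ first F.zero fk≡γ))
  ... | F.suc k , fk≡γ = ∪⁺ (image first) (image (f ∘ F.suc)) (inj₂ (image⁺ (f ∘ F.suc) k fk≡γ))

-- mark S: suc γ for a member γ of S, or zero if S is empty.  When S has at most
-- one member, this records S faithfully.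
mark : ∀ {K} → FinSet K → Fin (suc K)
mark S with FP.any? (λ γ → T? (S γ))
... | yes (γ , _) = F.suc γ
... | no  _       = F.zero

mark-suc : ∀ {K} (S : FinSet K) {ν} → mark S ≡ F.suc ν → ν ∈ S
mark-suc S markS≡ν with FP.any? (λ γ → T? (S γ))
mark-suc S refl | yes (_ , γ∈S) = γ∈S

mark-member : ∀ {K} (S : FinSet K) → (∀ {x y} → x ∈ S → y ∈ S → x ≡ y) →
  ∀ {ν} → ν ∈ S → mark S ≡ F.suc ν
mark-member S unique {ν} ν∈S with FP.any? (λ γ → T? (S γ))
... | yes (_ , γ∈S) = cong F.suc (unique γ∈S ν∈S)
... | no  none      = ⊥-elim (none (ν , ν∈S))

mark-empty : ∀ {K} (S : FinSet K) → (∀ x → ¬ x ∈ S) → mark S ≡ F.zero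
mark-empty S empty with FP.any? (λ γ → T? (S γ))
... | yes (γ , γ∈S) = ⊥-elim (empty γ γ∈S)
... | no  _         = refl

rank : ∀ {K} → FinSet K → Fin K → ℕ
rank S F.zero    = 0
rank S (F.suc x) = bit (S F.zero) + rank (S ∘ F.suc) x

rank-onto : ∀ {K} (S : FinSet K) j → j < ∣ S ∣ → ∃[ γ ] γ ∈ S × rank S γ ≡ j
rank-onto {suc K} S j j< with S F.zero in eq
rank-onto {suc K} S zero    j< | true = F.zero , subst T (sym eq) tt , refl
rank-onto {suc K} S (suc j) j< | true =
  let γ , γ∈S , rk = rank-onto (S ∘ F.suc) j (s≤s⁻¹ j<)
  in F.suc γ , γ∈S , trans (cong (λ b → bit b + rank (S ∘ F.suc) γ) eq) (cong suc rk)
rank-onto {suc K} S j       j< | false =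
  let γ , γ∈S , rk = rank-onto (S ∘ F.suc) j j<
  in F.suc γ , γ∈S , trans (cong (λ b → bit b + rank (S ∘ F.suc) γ) eq) rk

argmax : ∀ {m} (g : Fin (suc m) → ℕ) → ∃[ i ] (∀ j → g j ≤ g i)
argmax {zero}  g = F.zero , λ { F.zero → ≤-refl }
argmax {suc m} g with argmax (g ∘ F.suc)
... | i , max with ≤-total (g F.zero) (g (F.suc i))
... | inj₁ le = F.suc i , λ { F.zero → le ; (F.suc j) → max j }
... | inj₂ ge = F.zero , λ { F.zero → ≤-refl ; (F.suc j) → ≤-trans (max j) ge }

Distinct3 : ∀ {A : Set} → A → A → A → Set
Distinct3 x y z = x ≢ y × x ≢ z × y ≢ z

Distinct3-subst : ∀ {A : Set} {x x′ y y′ z z′ : A} →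
  x ≡ x′ → y ≡ y′ → z ≡ z′ → Distinct3 x y z → Distinct3 x′ y′ z′
Distinct3-subst refl refl refl distinct = distinct

rainbow-precompose : ∀ {m K L} (f : Fin m → Fin K) (g : Fin K → Fin L) →
  HasRainbow3AP (g ∘ f) → HasRainbow3AP f
rainbow-precompose f g (a , d , ap , c₁ , c₂ , c₃) =
  a , d , ap , c₁ ∘ cong g , c₂ ∘ cong g , c₃ ∘ cong g

rainbow? : ∀ {m K} (f : Fin m → Fin K) → Dec (HasRainbow3AP f)
rainbow? f = FP.any? λ a → FP.any? λ d →
  (¬? (toℕ d ≟ 0) ×-dec ¬? (a F.≟ (a ⊕ d)) ×-dec ¬? (a F.≟ ((a ⊕ d) ⊕ d))
     ×-dec ¬? ((a ⊕ d) F.≟ ((a ⊕ d) ⊕ d)))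
  ×-dec ¬? (f a F.≟ f (a ⊕ d)) ×-dec ¬? (f a F.≟ f ((a ⊕ d) ⊕ d))
  ×-dec ¬? (f (a ⊕ d) F.≟ f ((a ⊕ d) ⊕ d))

-- If every exact (r′+1)-colouring of ℤ_m has a rainbow 3-AP, then so does every
-- colouring using at least r′+1 colours: merge all colours of rank ≥ r′ into one.
merge-colours : ∀ {m K} r′ (f : Fin m → Fin K) →
  AllExactRainbow m (suc r′) → suc r′ ≤ ∣ image f ∣ → HasRainbow3AP f
merge-colours {K = K} r′ f all-rainbow enough = rainbow-precompose f merge (all-rainbow (merge ∘ f) onto)
  where
  merge : Fin K → Fin (suc r′)
  merge γ = fromℕ< (s≤s (m⊓n≤n (rank (image f) γ) r′))
  onto : Exact (merge ∘ f)
  onto y with rank-onto (image f) (toℕ y) (≤-trans (toℕ<n y) enough)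
  ... | γ , γ∈ , rank≡y with image⁻ f {γ} γ∈
  ... | k , refl = k , λ { refl → toℕ-injective (begin
    toℕ (merge γ)          ≡⟨ toℕ-fromℕ< _ ⟩
    rank (image f) γ ⊓ r′  ≡⟨ cong (_⊓ r′) rank≡y ⟩
    toℕ y ⊓ r′             ≡⟨ m≤n⇒m⊓n≡m (s≤s⁻¹ (toℕ<n y)) ⟩
    toℕ y                  ∎) }
    where open ≡-Reasoning

colours-below-aw : ∀ {m r K} → IsAw m r → (f : Fin m → Fin K) → ¬ HasRainbow3AP f →
  suc ∣ image f ∣ ≤ r
colours-below-aw {m} {r} (small , large) f free with m <? 3
... | yes m<3 = subst (suc ∣ image f ∣ ≤_) (trans (+-comm 1 m) (sym (small m<3))) (s≤s (∣image∣≤ f))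
... | no m≮3 with large (≮⇒≥ m≮3)
... | 1≤r , all-rainbow , _ with suc ∣ image f ∣ ≤? r
...   | yes fewer = fewer
...   | no ¬fewer = ⊥-elim (free (merge r 1≤r all-rainbow (≮⇒≥ ¬fewer)))
  where
  merge : ∀ r → 1 ≤ r → AllExactRainbow m r → r ≤ ∣ image f ∣ → HasRainbow3AP f
  merge (suc r′) _ = merge-colours r′ f

-- aw(ℤ_m,3) ≥ 2 for m ≥ 1: a constant colouring is an exact 1-colouring with no rainbow.
aw≥2 : ∀ {m r} → 1 ≤ m → IsAw m r → 2 ≤ r
aw≥2 {m} {r} 1≤m (small , large) with m <? 3
... | yes m<3 = subst (2 ≤_) (sym (trans (small m<3) (+-comm m 1))) (s≤s 1≤m)
... | no m≮3 with large (≮⇒≥ m≮3)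
... | 1≤r , all-rainbow , _ = not-one r 1≤r all-rainbow
  where
  not-one : ∀ r → 1 ≤ r → AllExactRainbow m r → 2 ≤ r
  not-one (suc (suc r′)) _ _ = s≤s (s≤s z≤n)
  not-one 1 _ all-rainbow with all-rainbow (λ _ → F.zero) (λ { F.zero → fromℕ< 1≤m , λ _ → refl })
  ... | _ , _ , _ , same , _ = ⊥-elim (same refl)

aw-below : ∀ {n a r} → IsAw n a → 3 ≤ n → 1 ≤ r → AllExactRainbow n r → a ≤ r
aw-below {a = a} {r} (_ , large) 3≤n 1≤r all-rainbow with a ≤? r
... | yes a≤r = a≤r
... | no  a≰r = ⊥-elim (proj₂ (proj₂ (large 3≤n)) r 1≤r (≰⇒> a≰r) all-rainbow)

module Residues (m′ : ℕ) where
  open Congruence m′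

  lift : ∀ {A : Set} → (Fin m → A) → ℕ → A
  lift f x = f (x mod m)

  triple⇒AP : ∀ {K} (f : Fin m → Fin K) p q r → p + r ≈ q + q →
    Distinct3 (lift f p) (lift f q) (lift f r) → HasRainbow3AP f
  triple⇒AP f p q r p+r≈2q distinct = a , d , (d≢0 , a≢b , a≢c , b≢c) , colours
    where
    a d : Fin m
    a = p mod m
    d = (q ⊖ p) mod m
    a+d≈q : toℕ a + toℕ d ≈ q
    a+d≈q = ≈-trans (≈-+ (toℕ-mod-≈ p) (toℕ-mod-≈ (q ⊖ p))) (⊖-inverse p q)
    q+d≈r : q + (q ⊖ p) ≈ r
    q+d≈r = ≈-cancelˡ p (begin
      p + (q + (q ⊖ p))  ≡⟨ exchange p q (q ⊖ p) ⟩
      q + (p + (q ⊖ p))  ≈⟨ ≈-+ (≈-refl {q}) (⊖-inverse p q) ⟩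
      q + q              ≈⟨ p+r≈2q ⟨
      p + r              ∎)
      where
      open ≈-Reasoning
      exchange : ∀ x y z → x + (y + z) ≡ y + (x + z)
      exchange = solve-∀
    b≡ : a ⊕ d ≡ q mod m
    b≡ = mod-cong a+d≈q
    c≡ : (a ⊕ d) ⊕ d ≡ r mod m
    c≡ = mod-cong (≈-trans (≈-+ (≈-trans (toℕ-mod-≈ _) a+d≈q) (toℕ-mod-≈ (q ⊖ p))) q+d≈r)
    colours : Distinct3 (f a) (f (a ⊕ d)) (f ((a ⊕ d) ⊕ d))
    colours = Distinct3-subst refl (cong f (sym b≡)) (cong f (sym c≡)) distinct
    a≢b : a ≢ a ⊕ d
    a≢b = proj₁ colours ∘ cong f
    a≢c : a ≢ (a ⊕ d) ⊕ d
    a≢c = proj₁ (proj₂ colours) ∘ cong f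
    b≢c : a ⊕ d ≢ (a ⊕ d) ⊕ d
    b≢c = proj₂ (proj₂ colours) ∘ cong f
    d≢0 : toℕ d ≢ 0
    d≢0 d≡0 = a≢b (sym (begin
      (toℕ a + toℕ d) mod m  ≡⟨ cong (λ u → (toℕ a + u) mod m) d≡0 ⟩
      (toℕ a + 0) mod m      ≡⟨ cong (_mod m) (+-identityʳ (toℕ a)) ⟩
      toℕ a mod m            ≡⟨ mod-toℕ a ⟩
      a                      ∎))
      where open ≡-Reasoning

  AP⇒triple : ∀ {K} (f : Fin m → Fin K) → HasRainbow3AP f →
    ∃[ p ] ∃[ q ] ∃[ r ] p + r ≡ q + q × Distinct3 (lift f p) (lift f q) (lift f r)
  AP⇒triple f (a , d , _ , distinct) =
    toℕ a , toℕ a + toℕ d , toℕ a + toℕ d + toℕ d , balance (toℕ a) (toℕ d) ,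
    Distinct3-subst (cong f (sym (mod-toℕ a))) refl (cong f (sym c≡)) distinct
    where
    c≡ : (toℕ a + toℕ d + toℕ d) mod m ≡ (a ⊕ d) ⊕ d
    c≡ = mod-cong (≈-+ (≈-sym (toℕ-mod-≈ (toℕ a + toℕ d))) ≈-refl)
    balance : ∀ x y → x + (x + y + y) ≡ (x + y) + (x + y)
    balance = solve-∀

-- The coset argument.  Fix s = 2h + 1, t = t′ + 1, n = st, and a colouring χ of
-- ℤ_n with N colours and no rainbow 3-AP.  Points of ℤ_n are handled as naturals.
module CosetArgument (h t′ : ℕ) {N : ℕ} (χ : Coloring (suc (2 * h) * suc t′) N)
                     (χ-free : ¬ HasRainbow3AP χ) where
  s t n′ : ℕ
  s  = suc (2 * h)
  t  = suc t′
  n′ = t′ + 2 * h * t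

  module ℤn = Congruence n′
  module ℤt = Congruence t′
  module ℤs = Congruence (2 * h)
  open ℤn using () renaming (_≈_ to _≈ₙ_)
  open ℤt using () renaming (_≈_ to _≈ₜ_)

  X : ℕ → Fin N
  X = Residues.lift n′ χ

  X-cong : ∀ {x y} → x ≈ₙ y → X x ≡ X y
  X-cong = cong χ ∘ ℤn.mod-cong

  ₙ⇒ₜ : ∀ {x y} → x ≈ₙ y → x ≈ₜ y
  ₙ⇒ₜ = ≈-divisor t′ n′ (divides s refl)

  no-rainbow-triple : ∀ p q r → p + r ≈ₙ q + q → X p ≡ X q ⊎ X p ≡ X r ⊎ X q ≡ X r
  no-rainbow-triple p q r p+r≈2q with X p F.≟ X q | X p F.≟ X r | X q F.≟ X r
  ... | yes same | _        | _        = inj₁ same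
  ... | no _     | yes same | _        = inj₂ (inj₁ same)
  ... | no _     | no _     | yes same = inj₂ (inj₂ same)
  ... | no c₁    | no c₂    | no c₃    =
    ⊥-elim (χ-free (Residues.triple⇒AP n′ χ p q r p+r≈2q (c₁ , c₂ , c₃)))

  coset-point : ∀ {w e} → w ≈ₜ e → ∃[ j ] w ≈ₙ e + t * j
  coset-point {w} {e} (Congruence.mod≡ w%t≡e%t) =
    w / t + 2 * h * (e / t) ,
    ℤn.≈-sym (ℤn.≈-trans (ℤn.≡⇒≈ decomposition) (ℤn.+-multiple w (e / t)))
    where
    rearrange : ∀ A B C h t′ → (A + C * suc t′) + suc t′ * (B + 2 * h * C)
                             ≡ (A + B * suc t′) + suc (2 * h) * suc t′ * C
    rearrange = solve-∀
    decomposition : e + t * (w / t + 2 * h * (e / t)) ≡ w + s * t * (e / t)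
    decomposition = begin
      e + t * (w / t + 2 * h * (e / t))                ≡⟨ cong (_+ t * (w / t + 2 * h * (e / t))) (m≡m%n+[m/n]*n e t) ⟩
      (e % t + e / t * t) + t * (w / t + 2 * h * (e / t)) ≡⟨ cong (λ u → (u + e / t * t) + t * (w / t + 2 * h * (e / t))) w%t≡e%t ⟨
      (w % t + e / t * t) + t * (w / t + 2 * h * (e / t)) ≡⟨ rearrange (w % t) (w / t) (e / t) h t′ ⟩
      (w % t + w / t * t) + s * t * (e / t)            ≡⟨ cong (_+ s * t * (e / t)) (m≡m%n+[m/n]*n w t) ⟨
      w + s * t * (e / t)                              ∎
      where open ≡-Reasoning

  t*-residue : ∀ j → t * toℕ (j mod s) ≈ₙ t * j
  t*-residue j = ℤn.≈-sym (ℤn.≈-trans (ℤn.≡⇒≈ decomposition) (ℤn.+-multiple _ (j / s)))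
    where
    rearrange : ∀ A B h t′ → suc t′ * (A + B * suc (2 * h)) ≡ suc t′ * A + suc (2 * h) * suc t′ * B
    rearrange = solve-∀
    decomposition : t * j ≡ t * toℕ (j mod s) + s * t * (j / s)
    decomposition = begin
      t * j                         ≡⟨ cong (t *_) (m≡m%n+[m/n]*n j s) ⟩
      t * (j % s + j / s * s)       ≡⟨ rearrange (j % s) (j / s) h t′ ⟩
      t * (j % s) + s * t * (j / s) ≡⟨ cong (λ u → t * u + s * t * (j / s)) (ℤs.toℕ-mod j) ⟨
      t * toℕ (j mod s) + s * t * (j / s) ∎
      where open ≡-Reasoning

  -- Halving inside cosets, the one place where s odd is used: if w ≡ 2e (mod t),
  -- then w ≡ 2y (mod n) for some y in the coset of e.
  midpoint : ∀ {w e} → w ≈ₜ e + e → ∃[ y ] y ≈ₜ e × w ≈ₙ y + y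
  midpoint {w} {e} w≈2e with coset-point w≈2e
  ... | j , w≈ = e + t * (j * suc h) , ℤt.+-multiple e (j * suc h) ,
    ℤn.≈-trans w≈ (ℤn.≈-sym (ℤn.≈-trans (ℤn.≡⇒≈ (doubling e j h t′)) (ℤn.+-multiple _ j)))
    where
    doubling : ∀ e j h t′ → (e + suc t′ * (j * suc h)) + (e + suc t′ * (j * suc h))
                          ≡ ((e + e) + suc t′ * j) + suc (2 * h) * suc t′ * j
    doubling = solve-∀

  Occurs : ℕ → Fin N → Set
  Occurs c γ = ∃[ x ] x ≈ₜ c × X x ≡ γ

  Occurs-resp : ∀ {c c′ γ} → c ≈ₜ c′ → Occurs c γ → Occurs c′ γ
  Occurs-resp c≈c′ (x , x≈c , seen) = x , ℤt.≈-trans x≈c c≈c′ , seen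

  Private : ℕ → ℕ → Fin N → Set
  Private p q γ = Occurs p γ × ¬ Occurs q γ

  occurs-differ : ∀ {c δ ε} → Occurs c δ → ¬ Occurs c ε → δ ≢ ε
  occurs-differ seen unseen refl = unseen seen

  extend : ∀ {u v w α β} → u + w ≈ₜ v + v → Occurs u α → Occurs v β → α ≢ β →
    Occurs w α ⊎ Occurs w β
  extend {u} {v} {w} u+w≈2v (x , x≈u , refl) (y , y≈v , refl) α≢β = conclude (no-rainbow-triple x y z x+z≈2y)
    where
    z : ℕ
    z = (y + y) ℤn.⊖ x
    x+z≈2y : x + z ≈ₙ y + y
    x+z≈2y = ℤn.⊖-inverse x (y + y)
    z≈w : z ≈ₜ w
    z≈w = ℤt.≈-cancelˡ u (begin
      u + z  ≈⟨ ℤt.≈-+ (ℤt.≈-sym x≈u) ℤt.≈-refl ⟩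
      x + z  ≈⟨ ₙ⇒ₜ x+z≈2y ⟩
      y + y  ≈⟨ ℤt.≈-+ y≈v y≈v ⟩
      v + v  ≈⟨ u+w≈2v ⟨
      u + w  ∎)
      where open ℤt.≈-Reasoning
    conclude : X x ≡ X y ⊎ X x ≡ X z ⊎ X y ≡ X z → Occurs w (X x) ⊎ Occurs w (X y)
    conclude (inj₁ same)        = ⊥-elim (α≢β same)
    conclude (inj₂ (inj₁ same)) = inj₁ (z , z≈w , sym same)
    conclude (inj₂ (inj₂ same)) = inj₂ (z , z≈w , sym same)

  interpolate : ∀ {u v w α β} → u + w ≈ₜ v + v → Occurs u α → Occurs w β → α ≢ β →
    Occurs v α ⊎ Occurs v β
  interpolate {u} {v} {w} u+w≈2v (x , x≈u , refl) (z , z≈w , refl) α≢β =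
    through (midpoint (ℤt.≈-trans (ℤt.≈-+ x≈u z≈w) u+w≈2v))
    where
    through : ∃[ y ] y ≈ₜ v × x + z ≈ₙ y + y → Occurs v (X x) ⊎ Occurs v (X z)
    through (y , y≈v , x+z≈2y) = conclude (no-rainbow-triple x y z x+z≈2y)
      where
      conclude : X x ≡ X y ⊎ X x ≡ X z ⊎ X y ≡ X z → Occurs v (X x) ⊎ Occurs v (X z)
      conclude (inj₁ same)        = inj₁ (y , y≈v , sym same)
      conclude (inj₂ (inj₁ same)) = ⊥-elim (α≢β same)
      conclude (inj₂ (inj₂ same)) = inj₂ (y , y≈v , same)

  exchange : ∀ {p q γ γ′ α α′} → γ ≢ γ′ → Private q p γ → Private q p γ′ →
    α ≢ α′ → Private p q α → Private p q α′ → ⊥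
  exchange {p} {q} γ≢γ′ (γq , γ∉p) (γ′q , γ′∉p) α≢α′ (αp , α∉q) (α′p , α′∉q) =
    [ α∉q , α′∉q ] (interpolate p+w≈2q αp α′w α≢α′)
    where
    w : ℕ
    w = (q + q) ℤt.⊖ p
    p+w≈2q : p + w ≈ₜ q + q
    p+w≈2q = ℤt.⊖-inverse p (q + q)
    -- α′ reappears in w: otherwise w sees both γ and γ′, forcing one of them into p.
    α′w : Occurs w _
    α′w with extend p+w≈2q α′p γq (occurs-differ α′p γ∉p)
           | extend p+w≈2q α′p γ′q (occurs-differ α′p γ′∉p)
    ... | inj₁ seen | _         = seen
    ... | inj₂ _    | inj₁ seen = seen
    ... | inj₂ γw   | inj₂ γ′w  =
      ⊥-elim ([ γ∉p , γ′∉p ] (extend (ℤt.≈-trans (ℤt.≡⇒≈ (+-comm w p)) p+w≈2q) γw γ′q γ≢γ′))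

  cosetColouring : ℕ → Fin s → Fin N
  cosetColouring c k = X (c + t * toℕ k)

  colours : ℕ → FinSet N
  colours c = image (cosetColouring c)

  colours⁻ : ∀ {c γ} → γ ∈ colours c → Occurs c γ
  colours⁻ {c} {γ} γ∈ with image⁻ (cosetColouring c) {γ} γ∈
  ... | k , refl = c + t * toℕ k , ℤt.+-multiple c (toℕ k) , refl

  colours⁺ : ∀ {c γ} → Occurs c γ → γ ∈ colours c
  colours⁺ {c} (x , x≈c , refl) with coset-point x≈c
  ... | j , x≈ = image⁺ (cosetColouring c) (j mod s)
                   (X-cong (ℤn.≈-trans (ℤn.≈-+ (ℤn.≈-refl {c}) (t*-residue j)) (ℤn.≈-sym x≈)))

  private⁻ : ∀ c c′ {γ} → γ ∈ colours c ∖ colours c′ → Private c c′ γ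
  private⁻ c c′ γ∈ with ∖⁻ (colours c) (colours c′) γ∈
  ... | inside , outside = colours⁻ inside , outside ∘ colours⁺

  private⁺ : ∀ c c′ {γ} → Private c c′ γ → γ ∈ colours c ∖ colours c′
  private⁺ c c′ (seen , unseen) = ∖⁺ (colours c) (colours c′) (colours⁺ seen) (unseen ∘ colours⁻)

  cosetColouring-free : ∀ c → ¬ HasRainbow3AP (cosetColouring c)
  cosetColouring-free c rainbow with Residues.AP⇒triple (2 * h) (cosetColouring c) rainbow
  ... | p , q , r , p+r≡2q , distinct =
    χ-free (Residues.triple⇒AP n′ χ (c + t * p) (c + t * q) (c + t * r) (ℤn.≡⇒≈ scaled)
              (Distinct3-subst (on p) (on q) (on r) distinct))
    where
    on : ∀ j → cosetColouring c (j mod s) ≡ X (c + t * j)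
    on j = X-cong (ℤn.≈-+ (ℤn.≈-refl {c}) (t*-residue j))
    regroup : ∀ c t x y → (c + t * x) + (c + t * y) ≡ (c + c) + t * (x + y)
    regroup = solve-∀
    scaled : (c + t * p) + (c + t * r) ≡ (c + t * q) + (c + t * q)
    scaled = begin
      (c + t * p) + (c + t * r)  ≡⟨ regroup c t p r ⟩
      (c + c) + t * (p + r)      ≡⟨ cong (λ u → (c + c) + t * u) p+r≡2q ⟩
      (c + c) + t * (q + q)      ≡⟨ regroup c t q q ⟨
      (c + t * q) + (c + t * q)  ∎
      where open ≡-Reasoning

  colourCount : Fin t → ℕ
  colourCount i = ∣ colours (toℕ i) ∣

  i₀ : Fin t
  i₀ = proj₁ (argmax {t′} colourCount)

  i₀-max : ∀ i → colourCount i ≤ colourCount i₀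
  i₀-max = proj₂ (argmax {t′} colourCount)

  c₀ : ℕ
  c₀ = toℕ i₀

  A : FinSet N
  A = colours c₀

  foreign : Fin t → FinSet N
  foreign i = colours (toℕ i) ∖ A

  -- Each coset has at most one foreign colour: two of them would leave, by the
  -- maximality of i₀, two colours of A missing from coset i, contradicting exchange.
  foreign-unique : ∀ i {γ γ′} → γ ∈ foreign i → γ′ ∈ foreign i → γ ≡ γ′
  foreign-unique i {γ} {γ′} γ∈ γ′∈ = decidable-stable (γ F.≟ γ′) two-foreign
    where
    two-foreign : γ ≢ γ′ → ⊥
    two-foreign γ≢γ′ = from-missing (two-members (A ∖ colours (toℕ i)) missing)
      where
      missing : 2 ≤ ∣ A ∖ colours (toℕ i) ∣
      missing = ≤-trans (∣∣-two {S = foreign i} γ≢γ′ γ∈ γ′∈) (∣∖∣-mono (colours (toℕ i)) A (i₀-max i))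
      from-missing : ∃₂ (λ α α′ → α ≢ α′ × α ∈ A ∖ colours (toℕ i) × α′ ∈ A ∖ colours (toℕ i)) → ⊥
      from-missing (α , α′ , α≢α′ , α∈ , α′∈) =
        exchange {c₀} {toℕ i} γ≢γ′ (private⁻ (toℕ i) c₀ γ∈) (private⁻ (toℕ i) c₀ γ′∈)
                 α≢α′ (private⁻ c₀ (toℕ i) α∈) (private⁻ c₀ (toℕ i) α′∈)

  φ : Fin t → Fin (suc N)
  φ i = mark (foreign i)

  φ-i₀ : φ i₀ ≡ F.zero
  φ-i₀ = mark-empty (foreign i₀) λ γ γ∈ → let inside , outside = ∖⁻ A A γ∈ in outside inside

  Φ : ℕ → Fin (suc N)
  Φ = Residues.lift t′ φ

  Φ-suc : ∀ {c ν} → Φ c ≡ F.suc ν → Private c c₀ ν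
  Φ-suc {c} Φc≡ν = map₁ (Occurs-resp (ℤt.toℕ-mod-≈ c))
    (private⁻ (toℕ (c mod t)) c₀ (mark-suc (foreign (c mod t)) Φc≡ν))

  Φ-marks : ∀ {c ν} → Private c c₀ ν → Φ c ≡ F.suc ν
  Φ-marks {c} (seen , unseen) = mark-member (foreign (c mod t)) (foreign-unique (c mod t))
    (private⁺ (toℕ (c mod t)) c₀ (Occurs-resp (ℤt.≈-sym (ℤt.toℕ-mod-≈ c)) seen , unseen))

  marks-again : ∀ a c {ν} → Φ a ≡ F.suc ν → Occurs c ν → Φ c ≡ F.suc ν
  marks-again a c Φa≡ν seen = Φ-marks {c} (seen , proj₂ (Φ-suc {a} Φa≡ν))

  occurs : ∀ c {ν} → Φ c ≡ F.suc ν → Occurs c ν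
  occurs c = proj₁ ∘ Φ-suc {c}

  -- φ is rainbow-free: two distinct foreign colours on a progression of cosets are
  -- carried by extend/interpolate to the third coset, which then repeats a mark.
  marks-not-distinct : ∀ {p q r} → p + r ≈ₜ q + q → ∀ x y z → Φ p ≡ x → Φ q ≡ y → Φ r ≡ z →
    ¬ Distinct3 x y z
  marks-not-distinct _ F.zero    F.zero    _         _ _ _ (d₁ , _)      = d₁ refl
  marks-not-distinct _ F.zero    (F.suc _) F.zero    _ _ _ (_ , d₂ , _)  = d₂ refl
  marks-not-distinct _ (F.suc _) F.zero    F.zero    _ _ _ (_ , _ , d₃)  = d₃ refl
  marks-not-distinct {p} {q} {r} p+r≈2q (F.suc ν) (F.suc ν′) _ Φp Φq Φr (d₁ , d₂ , d₃) =
    [ (λ seen → d₂ (trans (sym (marks-again p r Φp seen)) Φr))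
    , (λ seen → d₃ (trans (sym (marks-again q r Φq seen)) Φr)) ]
    (extend {p} {q} {r} p+r≈2q (occurs p Φp) (occurs q Φq) (d₁ ∘ cong F.suc))
  marks-not-distinct {p} {q} {r} p+r≈2q F.zero (F.suc ν) (F.suc ν′) Φp Φq Φr (_ , _ , d₃) =
    [ (λ seen → FP.0≢1+n (trans (sym Φp) (marks-again r p Φr seen)))
    , (λ seen → FP.0≢1+n (trans (sym Φp) (marks-again q p Φq seen))) ]
    (extend {r} {q} {p} (ℤt.≈-trans (ℤt.≡⇒≈ (+-comm r p)) p+r≈2q) (occurs r Φr) (occurs q Φq)
            (d₃ ∘ sym ∘ cong F.suc))
  marks-not-distinct {p} {q} {r} p+r≈2q (F.suc ν) F.zero (F.suc ν′) Φp Φq Φr (_ , d₂ , _) =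
    [ (λ seen → FP.0≢1+n (trans (sym Φq) (marks-again p q Φp seen)))
    , (λ seen → FP.0≢1+n (trans (sym Φq) (marks-again r q Φr seen))) ]
    (interpolate {p} {q} {r} p+r≈2q (occurs p Φp) (occurs r Φr) (d₂ ∘ cong F.suc))

  φ-free : ¬ HasRainbow3AP φ
  φ-free rainbow = on-triple (Residues.AP⇒triple t′ φ rainbow)
    where
    on-triple : ∃[ p ] ∃[ q ] ∃[ r ] p + r ≡ q + q × Distinct3 (Φ p) (Φ q) (Φ r) → ⊥
    on-triple (p , q , r , p+r≡2q , distinct) =
      marks-not-distinct {p} {q} {r} (ℤt.≡⇒≈ p+r≡2q) (Φ p) (Φ q) (Φ r) refl refl refl distinct

  marks : FinSet N
  marks = image φ ∘ F.suc

  seen-covered : ∀ {c γ} → Occurs c γ → γ ∈ A ∪ marks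
  seen-covered {c} {γ} seen = ∪⁺ A marks (map₂ marked (toSum (T? (A γ))))
    where
    marked : ¬ γ ∈ A → γ ∈ marks
    marked γ∉A = image⁺ φ (c mod t) (Φ-marks {c} (seen , γ∉A ∘ colours⁺))

  covered : Exact χ → ∀ γ → γ ∈ A ∪ marks
  covered onto γ = seen-covered {toℕ x} (toℕ x , ℤt.≈-refl , trans (cong χ (ℤn.mod-toℕ x)) (proj₂ (onto γ) refl))
    where
    x : Fin (suc n′)
    x = proj₁ (onto γ)

  -- Counting: N ≤ |A| + |marks|, with |A| ≤ aw(ℤ_s) − 1 and, since φ also takes the
  -- value zero, |marks| ≤ aw(ℤ_t) − 2.
  colour-bound : Exact χ → ∀ {b c} → IsAw t b → IsAw s c → N + 3 ≤ b + c
  colour-bound onto {b} {c} aw-t aw-s = begin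
    N + 3                        ≡⟨ cong (_+ 3) (∣full∣ N) ⟨
    ∣ full {N} ∣ + 3             ≤⟨ +-monoˡ-≤ 3 (∣∣-mono full (A ∪ marks) λ γ _ → covered onto γ) ⟩
    ∣ A ∪ marks ∣ + 3            ≤⟨ +-monoˡ-≤ 3 (∣∪∣≤ A marks) ⟩
    ∣ A ∣ + ∣ marks ∣ + 3        ≡⟨ rearrange ∣ A ∣ ∣ marks ∣ ⟩
    (2 + ∣ marks ∣) + suc ∣ A ∣  ≤⟨ +-mono-≤ marks-bound A-bound ⟩
    b + c                        ∎
    where
    open ≤-Reasoning
    rearrange : ∀ x y → x + y + 3 ≡ (2 + y) + suc x
    rearrange = solve-∀
    A-bound : suc ∣ A ∣ ≤ c
    A-bound = colours-below-aw aw-s (cosetColouring c₀) (cosetColouring-free c₀)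
    marks-bound : 2 + ∣ marks ∣ ≤ b
    marks-bound = subst (λ k → suc (k + ∣ marks ∣) ≤ b) (bit-member (image⁺ φ i₀ φ-i₀))
                        (colours-below-aw aw-t φ φ-free)

exact-colourings-rainbow : ∀ h t′ {b c} → IsAw (suc t′) b → IsAw (suc (2 * h)) c →
  AllExactRainbow (suc (2 * h) * suc t′) (b + c ∸ 2)
exact-colourings-rainbow h t′ {b} {c} aw-t aw-s χ onto = decidable-stable (rainbow? χ) too-many-colours
  where
  2≤b+c : 2 ≤ b + c
  2≤b+c = ≤-trans (aw≥2 {suc t′} (s≤s z≤n) aw-t) (m≤m+n b c)
  too-many-colours : ¬ HasRainbow3AP χ → ⊥
  too-many-colours free = <-irrefl refl (begin-strict
    b + c                ≡⟨ m∸n+n≡m 2≤b+c ⟨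
    b + c ∸ 2 + 2        <⟨ n<1+n _ ⟩
    suc (b + c ∸ 2 + 2)  ≡⟨ +-suc (b + c ∸ 2) 2 ⟨
    b + c ∸ 2 + 3        ≤⟨ CosetArgument.colour-bound h t′ χ free onto aw-t aw-s ⟩
    b + c                ∎)
    where open ≤-Reasoning

large-product : ∀ k t′ {a b c} → 3 ≤ suc (2 * k) * suc t′ → IsAw (suc (2 * k) * suc t′) a →
  IsAw (suc t′) b → IsAw (suc (2 * k)) c → a + 2 ≤ b + c
large-product k t′ {a} {b} {c} 3≤n aw-n aw-t aw-s = begin
  a + 2          ≤⟨ +-monoˡ-≤ 2 (aw-below aw-n 3≤n 1≤N (exact-colourings-rainbow k t′ aw-t aw-s)) ⟩
  b + c ∸ 2 + 2  ≡⟨ m∸n+n≡m (≤-trans 2≤b (m≤m+n b c)) ⟩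
  b + c          ∎
  where
  open ≤-Reasoning
  2≤b : 2 ≤ b
  2≤b = aw≥2 {suc t′} (s≤s z≤n) aw-t
  1≤N : 1 ≤ b + c ∸ 2
  1≤N = ≤-trans (s≤s z≤n) (∸-monoˡ-≤ 2 (+-mono-≤ 2≤b (aw≥2 {suc (2 * k)} (s≤s z≤n) aw-s)))

-- When ℤ_{st} has fewer than 3 elements, s = 1 and t ≤ 2, and the bound is an equality.
tiny-product : ∀ k t′ {a b c} → suc (2 * k) * suc t′ < 3 → IsAw (suc (2 * k) * suc t′) a →
  IsAw (suc t′) b → IsAw (suc (2 * k)) c → a + 2 ≤ b + c
tiny-product zero t′ {a} {b} {c} n<3 aw-n aw-t aw-s = ≤-reflexive (begin
  a + 2                  ≡⟨ cong (_+ 2) (proj₁ aw-n n<3) ⟩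
  suc t′ + 0 + 1 + 2     ≡⟨ cong (λ u → u + 1 + 2) (+-identityʳ (suc t′)) ⟩
  suc t′ + 1 + 2         ≡⟨ cong₂ _+_ (proj₁ aw-t t<3) (proj₁ aw-s (s≤s (s≤s z≤n))) ⟨
  b + c                  ∎)
  where
  open ≡-Reasoning
  t<3 : suc t′ < 3
  t<3 = subst (_< 3) (+-identityʳ (suc t′)) n<3
tiny-product (suc k) t′ n<3 _ _ _ =
  ⊥-elim (<⇒≱ n<3 (≤-trans (s≤s (*-monoʳ-≤ 2 (s≤s (z≤n {k})))) (m≤m*n (suc (2 * suc k)) (suc t′))))

proposition3p8 : (s t : ℕ) → 1 ≤ s → 1 ≤ t → Odd s
    → (Odd t ⊎ ∃[ m ] (1 ≤ m × t ≡ 2 ^ m))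
    → (a b c : ℕ) → IsAw (s * t) a → IsAw t b → IsAw s c
    → a + 2 ≤ b + c
proposition3p8 .(suc (2 * k)) (suc t′) _ (s≤s z≤n) (k , refl) _ a b c aw-n aw-t aw-s =
  [ (λ n<3 → tiny-product k t′ n<3 aw-n aw-t aw-s)
  , (λ n≮3 → large-product k t′ (≮⇒≥ n≮3) aw-n aw-t aw-s) ]
  (toSum (suc (2 * k) * suc t′ <? 3))
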